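{- Let $G = Z_{42}\times Z_{127}$ with multiplication $[x,y][u,v] = [x+u \bmod 42,\; y\cdot 27^{u} + v \bmod 127]$ (a group of order $5334$). Let $S=\{g,g^{ -1} : g\in\{[8,50],[27,15],[21,0]\}\}$. Then $S$ consists of exactly $5$ non-identity elements and the Cayley graph $\mathrm{Cay}(G,S)$ is a connected $5$-regular graph of diameter $7$ on $5334$ vertices.
   Context: For a finite group $G$ and an inverse-closed subset $S\subseteq G$ not containing the identity, the Cayley graph $\mathrm{Cay}(G,S)$ is the undirected graph with vertex set $G$ in which $x$ and $y$ are adjacent iff $y=xs$ for some $s\in S$; it is $|S|$-regular. The diameter of a connected graph is the maximum over all pairs of vertices of the length of a shortest path between them. For integers $m,n$ and a unit $a$ of $Z_n$ whose multiplicative order divides $m$, the group $m\times_a n$ is the set $Z_m\times Z_n$ with multiplication $[x,y][u,v]=[x+u \bmod m,\; y a^u+v \bmod n]$. -}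

module Defs where

open import Data.Nat using (ℕ; zero; suc; _+_; _*_; _^_; _≤_)
open import Data.Nat.DivMod using (_%_; m%n<n)
open import Data.Fin using (Fin; toℕ; fromℕ<)
open import Data.Product using (_×_; _,_; Σ; ∃; ∃-syntax)
open import Data.Sum using (_⊎_)
open import Data.List using (List; []; _∷_)
open import Data.List.Membership.Propositional using (_∈_)
open import Relation.Binary.PropositionalEquality using (_≡_)

mod : (n : ℕ) .{{_ : Data.Nat.NonZero n}} → ℕ → Fin n
mod n k = fromℕ< (m%n<n k n)

G : Set
G = Fin 42 × Fin 127

_·_ : G → G → G
(x , y) · (u , v) = mod 42 (toℕ x + toℕ u) , mod 127 (toℕ y * 27 ^ toℕ u + toℕ v)

e : G
e = (mod 42 0 , mod 127 0)

[_,_] : ℕ → ℕ → G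
[ a , b ] = (mod 42 a , mod 127 b)

gens : List G
gens = [ 8 , 50 ] ∷ [ 27 , 15 ] ∷ [ 21 , 0 ] ∷ []

-- S = { g, g⁻¹ : g ∈ gens }; s = g⁻¹ is expressed as s · g ≡ e
InS : G → Set
InS s = ∃[ g ] (g ∈ gens × (s ≡ g ⊎ s · g ≡ e))

Adj : G → G → Set
Adj x y = ∃[ s ] (InS s × y ≡ x · s)

data Walk : G → G → ℕ → Set where
  nil  : ∀ {x} → Walk x x 0
  step : ∀ {x y z n} → Adj x y → Walk y z n → Walk x z (suc n)

{-# OPTIONS --safe #-}
module Submission where

-- The semidirect product m ×_a n is a group as soon as a ^ m ≡ 1 (mod n): the only
-- modular fact associativity needs is that exponents of a may be reduced mod m.
--
-- The graph-theoretic claims are certified by the distance d from e, tabulated by a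
-- breadth-first search and then checked by evaluation over all 5334 vertices:
-- d e = 0, d grows by at most one along an edge, and every vertex other than e has a
-- neighbour closer to e. The second fact gives d y ≤ d x + n for every walk of length n
-- from x to y, so d [ 14 , 48 ] = 7 keeps that vertex at distance 7 from e. The third
-- gives a walk of length d x from x to e, which left translation turns into a walk
-- between any two vertices, so max d = 7 bounds the diameter.

open import Defs
open import Algebra.Bundles using (Group)
open import Algebra.Structures using (IsGroup)
open import Data.Fin as Fin using (Fin; toℕ)
import Data.Fin.Properties as Fin
open import Data.Fin.Properties using (toℕ-fromℕ<; toℕ-injective; toℕ<n)
open import Data.List using (List; []; _∷_; length; map)
open import Data.List.Membership.Propositional using (_∈_; _∉_; find)
open import Data.List.Membership.Propositional.Properties using (∈-map⁺; ∈-map⁻)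
open import Data.List.Relation.Unary.All as All using (All)
open import Data.List.Relation.Unary.Any as Any using (Any; here; there)
open import Data.List.Relation.Unary.Unique.Propositional using (Unique)
import Data.List.Relation.Unary.Unique.Propositional.Properties as Unique
open import Data.Nat using (ℕ; zero; suc; NonZero; _+_; _*_; _^_; _∸_; _≤_; _≟_; _≤?_)
open import Data.Nat.DivMod
  using (_%_; _/_; %-distribˡ-+; %-distribˡ-*; m%n%n≡m%n; m≡m%n+[m/n]*n; n%n≡0; m%n≤n; m<n⇒m%n≡m)
open import Data.Nat.Properties
  using ( +-assoc; +-identityʳ; *-identityʳ; *-comm; +-suc; suc-injective; ≤-reflexive; <⇒≤
        ; +-monoˡ-≤; m+[n∸m]≡n; ^-distribˡ-+-*; ^-*-assoc; m^n≢0; module ≤-Reasoning)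
open import Data.Nat.Tactic.RingSolver using (solve-∀)
open import Data.Product using (_×_; _,_; ∃-syntax; proj₁; proj₂; uncurry; curry)
open import Data.Product.Properties using (≡-dec)
open import Data.Sum as Sum using (_⊎_; inj₁; inj₂)
open import Data.Vec using (Vec; []; _∷_; lookup)
open import Function using (_∘_)
open import Function.Bundles using (_↔_; _⇔_; mk⇔; mk↔ₛ′)
open import Level using (0ℓ)
open import Relation.Binary using (DecidableEquality)
open import Relation.Binary.PropositionalEquality
  using (_≡_; refl; sym; trans; cong; cong₂; subst; subst₂; isEquivalence; module ≡-Reasoning)
open import Relation.Nullary using (¬_; Dec; contradiction)
open import Relation.Nullary.Decidable using (map′; toWitness; toWitnessFalse; _⊎-dec_)
open import Relation.Unary using (Decidable)

0%n≡0 : ∀ n .{{_ : NonZero n}} → 0 % n ≡ 0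
0%n≡0 (suc _) = refl

+-cong-% : ∀ {i j k l} d .{{_ : NonZero d}} → i % d ≡ j % d → k % d ≡ l % d → (i + k) % d ≡ (j + l) % d
+-cong-% {i} {j} {k} {l} d i≡j k≡l = begin
  (i + k) % d            ≡⟨ %-distribˡ-+ i k d ⟩
  (i % d + k % d) % d    ≡⟨ cong₂ (λ u v → (u + v) % d) i≡j k≡l ⟩
  (j % d + l % d) % d    ≡⟨ %-distribˡ-+ j l d ⟨
  (j + l) % d            ∎
  where open ≡-Reasoning

*-cong-% : ∀ {i j k l} d .{{_ : NonZero d}} → i % d ≡ j % d → k % d ≡ l % d → (i * k) % d ≡ (j * l) % d
*-cong-% {i} {j} {k} {l} d i≡j k≡l = begin
  (i * k) % d            ≡⟨ %-distribˡ-* i k d ⟩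
  (i % d * (k % d)) % d  ≡⟨ cong₂ (λ u v → (u * v) % d) i≡j k≡l ⟩
  (j % d * (l % d)) % d  ≡⟨ %-distribˡ-* j l d ⟨
  (j * l) % d            ∎
  where open ≡-Reasoning

^-%-period : ∀ {a m} n .{{_ : NonZero m}} .{{_ : NonZero n}} → a ^ m % n ≡ 1 % n →
             ∀ k → a ^ (k % m) % n ≡ a ^ k % n
^-%-period {a} {m} n a^m≡1 k = begin
  a ^ (k % m) % n                        ≡⟨ cong (_% n) (*-identityʳ (a ^ (k % m))) ⟨
  a ^ (k % m) * 1 % n                    ≡⟨ *-cong-% {a ^ (k % m)} n refl (powers-of-one (k / m)) ⟨
  a ^ (k % m) * (a ^ m) ^ (k / m) % n    ≡⟨ cong (λ t → a ^ (k % m) * t % n) (^-*-assoc a m (k / m)) ⟩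
  a ^ (k % m) * a ^ (m * (k / m)) % n    ≡⟨ cong (_% n) (^-distribˡ-+-* a (k % m) (m * (k / m))) ⟨
  a ^ (k % m + m * (k / m)) % n          ≡⟨ cong (λ t → a ^ (k % m + t) % n) (*-comm m (k / m)) ⟩
  a ^ (k % m + k / m * m) % n            ≡⟨ cong (λ t → a ^ t % n) (m≡m%n+[m/n]*n k m) ⟨
  a ^ k % n                              ∎
  where
  open ≡-Reasoning
  powers-of-one : ∀ q → (a ^ m) ^ q % n ≡ 1 % n
  powers-of-one zero    = refl
  powers-of-one (suc q) = *-cong-% n a^m≡1 (powers-of-one q)

toℕ-mod : ∀ d .{{_ : NonZero d}} k → toℕ (mod d k) ≡ k % d
toℕ-mod d k = toℕ-fromℕ< _

toℕ-mod-0 : ∀ d .{{_ : NonZero d}} → toℕ (mod d 0) ≡ 0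
toℕ-mod-0 d = trans (toℕ-mod d 0) (0%n≡0 d)

toℕ-mod-% : ∀ d .{{_ : NonZero d}} k → toℕ (mod d k) % d ≡ k % d
toℕ-mod-% d k = trans (cong (_% d) (toℕ-mod d k)) (m%n%n≡m%n k d)

mod-cong : ∀ d .{{_ : NonZero d}} {i j} → i % d ≡ j % d → mod d i ≡ mod d j
mod-cong d {i} {j} i≡j = toℕ-injective (trans (toℕ-mod d i) (trans i≡j (sym (toℕ-mod d j))))

mod-toℕ : ∀ {d} .{{_ : NonZero d}} (i : Fin d) → mod d (toℕ i) ≡ i
mod-toℕ {d} i = toℕ-injective (trans (toℕ-mod d (toℕ i)) (m<n⇒m%n≡m (toℕ<n i)))

module SemidirectProduct (m n a : ℕ) .{{_ : NonZero m}} .{{_ : NonZero n}}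
                         (a^m≡1 : a ^ m % n ≡ 1 % n) where

  open ≡-Reasoning

  Carrier : Set
  Carrier = Fin m × Fin n

  infixl 7 _∙_
  _∙_ : Carrier → Carrier → Carrier
  (x , y) ∙ (u , v) = mod m (toℕ x + toℕ u) , mod n (toℕ y * a ^ toℕ u + toℕ v)

  ε : Carrier
  ε = mod m 0 , mod n 0

  infix 8 _⁻¹
  _⁻¹ : Carrier → Carrier
  (x , y) ⁻¹ = mod m (m ∸ toℕ x) , mod n (n ∸ toℕ y * a ^ (m ∸ toℕ x) % n)

  ^-toℕ-mod : ∀ k → a ^ toℕ (mod m k) % n ≡ a ^ k % n
  ^-toℕ-mod k = trans (cong (λ t → a ^ t % n) (toℕ-mod m k)) (^-%-period n a^m≡1 k)

  ∙-assoc : ∀ p q r → (p ∙ q) ∙ r ≡ p ∙ (q ∙ r)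
  ∙-assoc (x , y) (u , v) (w , t) = cong₂ _,_ (mod-cong m first) (mod-cong n second)
    where
    X = toℕ x; Y = toℕ y; U = toℕ u; V = toℕ v; W = toℕ w; T = toℕ t
    first : (toℕ (mod m (X + U)) + W) % m ≡ (X + toℕ (mod m (U + W))) % m
    first = begin
      (toℕ (mod m (X + U)) + W) % m  ≡⟨ +-cong-% m (toℕ-mod-% m (X + U)) refl ⟩
      (X + U + W) % m                ≡⟨ cong (_% m) (+-assoc X U W) ⟩
      (X + (U + W)) % m              ≡⟨ +-cong-% m refl (toℕ-mod-% m (U + W)) ⟨
      (X + toℕ (mod m (U + W))) % m  ∎
    regroup : ∀ y p v q t → (y * p + v) * q + t ≡ y * (p * q) + (v * q + t)
    regroup = solve-∀
    second : (toℕ (mod n (Y * a ^ U + V)) * a ^ W + T) % n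
           ≡ (Y * a ^ toℕ (mod m (U + W)) + toℕ (mod n (V * a ^ W + T))) % n
    second = begin
      (toℕ (mod n (Y * a ^ U + V)) * a ^ W + T) % n
        ≡⟨ +-cong-% n (*-cong-% n (toℕ-mod-% n (Y * a ^ U + V)) refl) refl ⟩
      ((Y * a ^ U + V) * a ^ W + T) % n
        ≡⟨ cong (_% n) (regroup Y (a ^ U) V (a ^ W) T) ⟩
      (Y * (a ^ U * a ^ W) + (V * a ^ W + T)) % n
        ≡⟨ cong (λ p → (Y * p + (V * a ^ W + T)) % n) (^-distribˡ-+-* a U W) ⟨
      (Y * a ^ (U + W) + (V * a ^ W + T)) % n
        ≡⟨ +-cong-% n (*-cong-% {Y} n refl (^-toℕ-mod (U + W))) (toℕ-mod-% n (V * a ^ W + T)) ⟨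
      (Y * a ^ toℕ (mod m (U + W)) + toℕ (mod n (V * a ^ W + T))) % n  ∎

  ∙-identityˡ : ∀ p → ε ∙ p ≡ p
  ∙-identityˡ (u , v) = cong₂ _,_
    (trans (cong (λ t → mod m (t + toℕ u)) (toℕ-mod-0 m)) (mod-toℕ u))
    (trans (cong (λ t → mod n (t * a ^ toℕ u + toℕ v)) (toℕ-mod-0 n)) (mod-toℕ v))

  ∙-identityʳ : ∀ p → p ∙ ε ≡ p
  ∙-identityʳ (x , y) = cong₂ _,_
    (begin
      mod m (toℕ x + toℕ (mod m 0))  ≡⟨ cong (λ t → mod m (toℕ x + t)) (toℕ-mod-0 m) ⟩
      mod m (toℕ x + 0)              ≡⟨ cong (mod m) (+-identityʳ (toℕ x)) ⟩
      mod m (toℕ x)                  ≡⟨ mod-toℕ x ⟩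
      x                              ∎)
    (begin
      mod n (toℕ y * a ^ toℕ (mod m 0) + toℕ (mod n 0))
        ≡⟨ cong₂ (λ s t → mod n (toℕ y * a ^ s + t)) (toℕ-mod-0 m) (toℕ-mod-0 n) ⟩
      mod n (toℕ y * 1 + 0)  ≡⟨ cong (mod n) (trans (+-identityʳ _) (*-identityʳ (toℕ y))) ⟩
      mod n (toℕ y)          ≡⟨ mod-toℕ y ⟩
      y                      ∎)

  ∙-inverseʳ : ∀ p → p ∙ p ⁻¹ ≡ ε
  ∙-inverseʳ (x , y) = cong₂ _,_ (mod-cong m first) (mod-cong n second)
    where
    X = toℕ x; Y = toℕ y
    first : (X + toℕ (mod m (m ∸ X))) % m ≡ 0 % m
    first = begin
      (X + toℕ (mod m (m ∸ X))) % m  ≡⟨ +-cong-% {X} m refl (toℕ-mod-% m (m ∸ X)) ⟩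
      (X + (m ∸ X)) % m              ≡⟨ cong (_% m) (m+[n∸m]≡n (<⇒≤ (toℕ<n x))) ⟩
      m % m                          ≡⟨ trans (n%n≡0 m) (sym (0%n≡0 m)) ⟩
      0 % m                          ∎
    r = Y * a ^ (m ∸ X)
    second : (Y * a ^ toℕ (mod m (m ∸ X)) + toℕ (mod n (n ∸ r % n))) % n ≡ 0 % n
    second = begin
      (Y * a ^ toℕ (mod m (m ∸ X)) + toℕ (mod n (n ∸ r % n))) % n
        ≡⟨ +-cong-% n (trans (*-cong-% {Y} n refl (^-toℕ-mod (m ∸ X))) (sym (m%n%n≡m%n r n)))
                      (toℕ-mod-% n (n ∸ r % n)) ⟩
      (r % n + (n ∸ r % n)) % n  ≡⟨ cong (_% n) (m+[n∸m]≡n (m%n≤n r n)) ⟩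
      n % n                      ≡⟨ trans (n%n≡0 n) (sym (0%n≡0 n)) ⟩
      0 % n                      ∎

  ∙-inverseˡ : ∀ p → p ⁻¹ ∙ p ≡ ε
  ∙-inverseˡ p = begin
    p ⁻¹ ∙ p                        ≡⟨ ∙-identityʳ (p ⁻¹ ∙ p) ⟨
    p ⁻¹ ∙ p ∙ ε                    ≡⟨ cong (p ⁻¹ ∙ p ∙_) (∙-inverseʳ (p ⁻¹)) ⟨
    p ⁻¹ ∙ p ∙ (p ⁻¹ ∙ p ⁻¹ ⁻¹)     ≡⟨ ∙-assoc (p ⁻¹) p _ ⟩
    p ⁻¹ ∙ (p ∙ (p ⁻¹ ∙ p ⁻¹ ⁻¹))   ≡⟨ cong (p ⁻¹ ∙_) (∙-assoc p (p ⁻¹) _) ⟨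
    p ⁻¹ ∙ (p ∙ p ⁻¹ ∙ p ⁻¹ ⁻¹)     ≡⟨ cong (λ q → p ⁻¹ ∙ (q ∙ p ⁻¹ ⁻¹)) (∙-inverseʳ p) ⟩
    p ⁻¹ ∙ (ε ∙ p ⁻¹ ⁻¹)            ≡⟨ cong (p ⁻¹ ∙_) (∙-identityˡ (p ⁻¹ ⁻¹)) ⟩
    p ⁻¹ ∙ p ⁻¹ ⁻¹                  ≡⟨ ∙-inverseʳ (p ⁻¹) ⟩
    ε                               ∎

  isGroup : IsGroup _≡_ _∙_ ε _⁻¹
  isGroup = record
    { isMonoid = record
      { isSemigroup = record
        { isMagma = record { isEquivalence = isEquivalence ; ∙-cong = cong₂ _∙_ }
        ; assoc   = ∙-assoc
        }
      ; identity = ∙-identityˡ , ∙-identityʳ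
      }
    ; inverse = ∙-inverseˡ , ∙-inverseʳ
    ; ⁻¹-cong = cong _⁻¹
    }

  group : Group 0ℓ 0ℓ
  group = record { isGroup = isGroup }

open SemidirectProduct 42 127 27 refl using (_⁻¹; group)
open Group group using () renaming (assoc to ·-assoc; identityʳ to ·-identityʳ; inverseˡ to ·-inverseˡ)
open import Algebra.Properties.Group group using (∙-cancelˡ; inverseˡ-unique; \\-leftDividesˡ)

infix 4 _≟ᴳ_
_≟ᴳ_ : DecidableEquality G
_≟ᴳ_ = ≡-dec Fin._≟_ Fin._≟_

open import Data.List.Membership.DecPropositional _≟ᴳ_ using (_∈?_)
open import Data.List.Relation.Unary.Unique.DecPropositional _≟ᴳ_ using (unique?)

allG? : {P : G → Set} → Decidable P → Dec (∀ x → P x)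
allG? P? = map′ uncurry curry (Fin.all? λ a → Fin.all? λ b → P? (a , b))

-- [ 21 , 0 ] is an involution, so listing each generator and its inverse gives five elements.
S : List G
S = [ 8 , 50 ] ∷ [ 8 , 50 ] ⁻¹ ∷ [ 27 , 15 ] ∷ [ 27 , 15 ] ⁻¹ ∷ [ 21 , 0 ] ∷ []

S-unique : Unique S
S-unique = toWitness {a? = unique? S} _

e∉S : e ∉ S
e∉S = toWitnessFalse {a? = e ∈? S} _

generator∈S : ∀ {g} → g ∈ gens → g ∈ S × g ⁻¹ ∈ S
generator∈S (here refl)                 = here refl , there (here refl)
generator∈S (there (here refl))         = there (there (here refl)) , there (there (there (here refl)))
generator∈S (there (there (here refl))) = there (there (there (there (here refl))))
                                        , there (there (there (there (here refl))))

InS⇒∈S : ∀ {s} → InS s → s ∈ S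
InS⇒∈S (g , g∈gens , inj₁ refl)  = proj₁ (generator∈S g∈gens)
InS⇒∈S (g , g∈gens , inj₂ s·g≡e) =
  subst (_∈ S) (sym (inverseˡ-unique _ g s·g≡e)) (proj₂ (generator∈S g∈gens))

∈S⇒InS : ∀ {s} → s ∈ S → InS s
∈S⇒InS (here refl)                                 = [ 8 , 50 ] , here refl , inj₁ refl
∈S⇒InS (there (here refl))                         = [ 8 , 50 ] , here refl , inj₂ (·-inverseˡ [ 8 , 50 ])
∈S⇒InS (there (there (here refl)))                 = [ 27 , 15 ] , there (here refl) , inj₁ refl
∈S⇒InS (there (there (there (here refl))))         = [ 27 , 15 ] , there (here refl) , inj₂ (·-inverseˡ [ 27 , 15 ])
∈S⇒InS (there (there (there (there (here refl))))) = [ 21 , 0 ] , there (there (here refl)) , inj₁ refl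

neighbours : ∀ x → ∃[ L ] (length L ≡ 5 × Unique L × (∀ y → Adj x y ⇔ y ∈ L))
neighbours x = map (x ·_) S , refl , Unique.map⁺ (∙-cancelˡ x _ _) S-unique , λ y → mk⇔ to from
  where
  to : ∀ {y} → Adj x y → y ∈ map (x ·_) S
  to (s , s∈S , refl) = ∈-map⁺ (x ·_) (InS⇒∈S s∈S)
  from : ∀ {y} → y ∈ map (x ·_) S → Adj x y
  from y∈ with ∈-map⁻ (x ·_) y∈
  ... | s , s∈S , refl = s , ∈S⇒InS s∈S , refl

translate : ∀ g {x y n} → Walk x y n → Walk (g · x) (g · y) n
translate g nil                           = nil
translate g {x} (step (s , s∈S , refl) w) = step (s , s∈S , sym (·-assoc g x s)) (translate g w)

record DistanceLabelling (d : G → ℕ) : Set where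
  field
    at-identity : d e ≡ 0
    neighbour-≤ : ∀ x {s} → InS s → d (x · s) ≤ suc (d x)
    descend     : ∀ x → x ≡ e ⊎ ∃[ s ] (InS s × suc (d (x · s)) ≡ d x)

module _ {d : G → ℕ} (D : DistanceLabelling d) where
  open DistanceLabelling D

  walk⇒≤ : ∀ {x y n} → Walk x y n → d y ≤ d x + n
  walk⇒≤ {x} nil = ≤-reflexive (sym (+-identityʳ (d x)))
  walk⇒≤ {x} {y} {suc n} (step (s , s∈S , refl) w) = begin
    d y             ≤⟨ walk⇒≤ w ⟩
    d (x · s) + n   ≤⟨ +-monoˡ-≤ n (neighbour-≤ x s∈S) ⟩
    suc (d x) + n   ≡⟨ +-suc (d x) n ⟨
    d x + suc n     ∎
    where open ≤-Reasoning

  walk-to-identity : ∀ x → Walk x e (d x)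
  walk-to-identity x = walk-of-length (d x) x refl
    where
    walk-of-length : ∀ k x → d x ≡ k → Walk x e k
    walk-of-length k x dx≡k with descend x
    ... | inj₁ refl = subst (Walk e e) (trans (sym at-identity) dx≡k) nil
    walk-of-length zero x dx≡0 | inj₂ (s , _ , eq) = contradiction (trans eq dx≡0) λ ()
    walk-of-length (suc k) x dx≡k | inj₂ (s , s∈S , eq) =
      step (s , s∈S , refl) (walk-of-length k (x · s) (suc-injective (trans eq dx≡k)))

-- Row x lists d [ x , 0 ], …, d [ x , 126 ] as base-8 digits, least significant first.
distanceRows : Vec ℕ 42
distanceRows =
  4221642970611558950546107351988039146727167404005907143322947156991416285953774813304480832587301120393981483249072 ∷
  4222829791917273763298732127607667425091007982986116195662744490617931919148178637855047681176855463661385853664758 ∷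
  4827696635304104535832878352901538475487333052871607401111139599479572607719734067725066581030684825164117799067133 ∷
  3596217493807784031951903655403797189333589339349614526930037691082651255183559603713290002785864377228166029863863 ∷
  3682815084761320742985888021722475510830193812450767514996220264373497441485309780754096184722894308242106546580911 ∷
  4308216964922420201333253349367936067214129565933458462729878166837576628632134980474271771465180201197402035019637 ∷
  4296195656798237269365072741750404533965196739257113101230747890490969202569245555206724775028568269395810561454007 ∷
  4838502023508504831006430006171787055120759596218106724491679434604608711446157262393378895806729851074288448929206 ∷
  4220572874669194681183428169105933851520279939591106168706288130886855140811313654436594061957045770825909411511798 ∷
  4308201365825952609437449561725113150775866081289657981385641521235055949743504496054002225627633066678673474776551 ∷
  4213228067847555341406093299036438608779468655111061878599363582319714347382308435410193780458143502254940039639030 ∷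
  3616656639952467897865685460805815039919174440211663753359396514138777446230759203901037899678425303443246212087662 ∷
  4288999464707476283299499329131575156851152676230498607917767657744680873063045293504705776037516702782243919846847 ∷
  4683386055802722663656793662002644136338536515530557756205872513911434836374962118987876250026590669674524049624886 ∷
  4587318688092119422724373251995211193485067596974799950119512143964963575724985647953598718784385470123922224016759 ∷
  3596369598697728897780780558700414688202803716138238996053230582233750111491484107739518288773802054540978053373806 ∷
  4221796175736771279388189240214525834617112338243016493832265455955246713938941608737616223987619672819429784870316 ∷
  4077179676543915220067791367447261711612760453051826171566092002070574353705028337597377708259223485507538748141374 ∷
  4299636276323288155368976270703709305573903486636774227310462085548716273680660193973623603914995252566698380192630 ∷
  2981908953686330601518964420826352617983495490729083903529956971500135193957863916831445146675473036433144881573302 ∷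
  4914249608506630399959910457439044890822926620057927511860237933034702233598830226587951112954054114493854096780790 ∷
  3693937456935717549897560529219971880045292075869332436804875462699303781117452436284696374540527450347034208370681 ∷
  4914106531032174189701912094093583481820057454239224366387906689483323576996201305556537006555217094555851300760510 ∷
  4221662263512972998807423502109370914622963252926512089401275209028716798534089974273943361659543210431290013380094 ∷
  4201180596056049545638551288013694454854852330392839008412911703934315083111671758570452878422207569680363738070446 ∷
  4220140485737007119178262388149760976774428272419254641956644786068707841707209211731122655274668944526687893945830 ∷
  4231243774684847501956894332877039706383820996611094456780383401689178090349248436123314870237847168318037573725628 ∷
  4297268945266188727580882141452558522772836247246013786225734722234915870074157058499848808181732836741478665347062 ∷
  4906008792454814224975831894089645636040349441049260807406367082786491089377680427384614669924686670770560803798903 ∷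
  4308180260417011604428449495526843294794573359185703216612797679143384594456405955251928913615074528395155233041846 ∷
  3693747807006319406596011742750159465642298331670994105721073458861026222347336670965913968491060781781771238170031 ∷
  4838485586514694862303784309785879092246603060135177321101678777339662495025887833408016307826062415619048311881206 ∷
  2990161732990459302719415698491932619196099869896085792613406210739223674372778518800358624300527941411117215940534 ∷
  4220309579735588789652414149380133375489076335466895548645420179601320619559862512636196397235776988710729943051775 ∷
  4759272132210801871519362149931809458584727348540966228115249020894666728424203616168865201819400389881688183234302 ∷
  4672563701602592172555147615483128081019002725339449020278077413108303737309011084461688241374919708826272437861174 ∷
  4221643489343158319476161727659681993858778765010071709918727008016323031789746152308806273663870462950183271886247 ∷
  3596388711711472083657233682975317057245379391639260844161746451207010259526830051259261103088834556053958293941685 ∷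
  3989419630225900092856134044252636820219671583363993265636789024286458042789383406537740618687862447376498513076095 ∷
  4222808727853883113423202865190025846020369086236689911020261799245445853981465066049007950722626400514258077449655 ∷
  3529003962616616107437673934298836304143767676441110901748313516562144761507526067680873301944155559117343397182893 ∷
  4211868886669434769222249883414212297407926548721260806125036906569001907009649156800665386737568931837593754794998 ∷
  []

dist : G → ℕ
dist (x , y) = octalDigit (toℕ y) (lookup distanceRows x)
  where
  octalDigit : ℕ → ℕ → ℕ
  octalDigit i r = (r / 8 ^ i) {{m^n≢0 8 i}} % 8

dist-neighbour-≤ : ∀ x → All (λ s → dist (x · s) ≤ suc (dist x)) S
dist-neighbour-≤ = toWitness {a? = allG? λ x → All.all? (λ s → dist (x · s) ≤? suc (dist x)) S} _

dist-descend : ∀ x → x ≡ e ⊎ Any (λ s → suc (dist (x · s)) ≡ dist x) S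
dist-descend = toWitness {a? = allG? λ x → (x ≟ᴳ e) ⊎-dec Any.any? (λ s → suc (dist (x · s)) ≟ dist x) S} _

dist-≤-7 : ∀ x → dist x ≤ 7
dist-≤-7 = toWitness {a? = allG? λ x → dist x ≤? 7} _

dist-labelling : DistanceLabelling dist
dist-labelling = record
  { at-identity = refl
  ; neighbour-≤ = λ x s∈S → All.lookup (dist-neighbour-≤ x) (InS⇒∈S s∈S)
  ; descend     = λ x → Sum.map₂ (closer-neighbour x) (dist-descend x)
  }
  where
  closer-neighbour : ∀ x → Any (λ s → suc (dist (x · s)) ≡ dist x) S →
                     ∃[ s ] (InS s × suc (dist (x · s)) ≡ dist x)
  closer-neighbour x p with find p
  ... | s , s∈S , eq = s , ∈S⇒InS s∈S , eq

walk-between : ∀ x y → Walk x y (dist ((y ⁻¹) · x))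
walk-between x y = subst₂ (λ u v → Walk u v (dist ((y ⁻¹) · x))) (\\-leftDividesˡ y x) (·-identityʳ y)
  (translate y (walk-to-identity dist-labelling ((y ⁻¹) · x)))

far-from-e : ∀ n → Walk e [ 14 , 48 ] n → 7 ≤ n
far-from-e n = walk⇒≤ dist-labelling

G↔Fin5334 : G ↔ Fin 5334
G↔Fin5334 = mk↔ₛ′ (uncurry Fin.combine) (Fin.remQuot 127) (Fin.combine-remQuot 127) (uncurry Fin.remQuot-combine)

mainTheorem3 :
    -- S has exactly 5 elements, none of them the identity
    (∃[ L ] (length L ≡ 5 × Unique L × (∀ s → InS s ⇔ s ∈ L)))
    × (¬ InS e)
    -- 5-regular: every vertex has exactly 5 neighbours
    × (∀ x → ∃[ L ] (length L ≡ 5 × Unique L × (∀ y → Adj x y ⇔ y ∈ L)))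
    -- connected with diameter ≤ 7: every pair joined by a walk of length ≤ 7
    × (∀ x y → ∃[ n ] (n ≤ 7 × Walk x y n))
    -- diameter ≥ 7: some pair at distance at least 7
    × (∃[ x ] ∃[ y ] (∀ n → Walk x y n → 7 ≤ n))
    -- 5334 vertices
    × (G ↔ Fin 5334)
mainTheorem3 =
    (S , refl , S-unique , λ s → mk⇔ InS⇒∈S ∈S⇒InS)
  , e∉S ∘ InS⇒∈S
  , neighbours
  , (λ x y → dist ((y ⁻¹) · x) , dist-≤-7 ((y ⁻¹) · x) , walk-between x y)
  , (e , [ 14 , 48 ] , far-from-e)
  , G↔Fin5334
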